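{- Let $B_{6,3}$ be the graph obtained from two triangles sharing exactly one common vertex $c$ by attaching one pendent vertex at $c$. Then every orientation $D$ of $B_{6,3}$ satisfies $M_1(D)\leq 19$, with equality if and only if $D$ is isomorphic to $B^{(1)}_{6,3}$ or $B^{(2)}_{6,3}$.
   Context: An orientation $D$ of a graph is obtained by replacing each edge $xy$ by exactly one of the arcs $xy$ or $yx$. For a vertex $x$ of $D$, $d^+_x$ and $d^-_x$ denote its out-degree and in-degree. The first Zagreb index of a digraph $D=(V,A)$ is $M_1(D)=\frac{1}{2}\sum_{xy\in A}(d^+_x+d^-_y)$. $B^{(1)}_{6,3}$ is the orientation of $B_{6,3}$ in which all five edges incident with $c$ are oriented away from $c$ and, in each triangle $c\,x\,y$, the edge $xy$ is oriented in either direction (both choices give isomorphic digraphs); $B^{(2)}_{6,3}$ is obtained from $B^{(1)}_{6,3}$ by reversing every arc. -}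

module Defs where

open import Data.Nat using (ℕ; _+_; _*_; _/_)
open import Data.Bool using (Bool; true; false; if_then_else_; _∧_; _∨_)
open import Data.Fin using (Fin; zero; suc; _≟_)
open import Data.List using (List; map; allFin)
open import Data.Nat.ListAction using (sum)
open import Data.Bool.ListAction using (or)
open import Data.Product using (_×_; _,_; proj₁; proj₂)
open import Relation.Nullary.Decidable using (⌊_⌋)
open import Relation.Binary.PropositionalEquality using (_≡_)
open import Function.Bundles using (_↔_; Inverse)

Digraph : ℕ → Set
Digraph n = Fin n → Fin n → Bool

-- Vertices of B_{6,3}: 0 = c, triangles c-1-2 and c-3-4, pendent vertex 5 at c.
-- The 7 edges of B_{6,3}, each listed as an ordered pair (u , v).
edge : Fin 7 → Fin 6 × Fin 6
edge zero = (zero , suc zero)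
edge (suc zero) = (zero , suc (suc zero))
edge (suc (suc zero)) = (zero , suc (suc (suc zero)))
edge (suc (suc (suc zero))) = (zero , suc (suc (suc (suc zero))))
edge (suc (suc (suc (suc zero)))) = (zero , suc (suc (suc (suc (suc zero)))))
edge (suc (suc (suc (suc (suc zero))))) = (suc zero , suc (suc zero))
edge (suc (suc (suc (suc (suc (suc zero)))))) = (suc (suc (suc zero)) , suc (suc (suc (suc zero))))

-- An orientation of B_{6,3}: for each edge a direction
-- (true: edge (u , v) becomes arc uv;  false: it becomes arc vu).
Orientation : Set
Orientation = Fin 7 → Bool

eqF : Fin 6 → Fin 6 → Bool
eqF a b = ⌊ a ≟ b ⌋

tail head : Orientation → Fin 7 → Fin 6
tail o e = if o e then proj₁ (edge e) else proj₂ (edge e)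
head o e = if o e then proj₂ (edge e) else proj₁ (edge e)

orient : Orientation → Digraph 6
orient o x y = or (map (λ e → eqF x (tail o e) ∧ eqF y (head o e)) (allFin 7))

reverse : ∀ {n} → Digraph n → Digraph n
reverse A x y = A y x

-- B^(1)_{6,3}: all edges at c oriented away from c, and 1→2, 3→4.
B1 : Digraph 6
B1 = orient (λ _ → true)

B2 : Digraph 6
B2 = reverse B1

b2n : Bool → ℕ
b2n true = 1
b2n false = 0

outdeg indeg : ∀ {n} → Digraph n → Fin n → ℕ
outdeg {n} A x = sum (map (λ y → b2n (A x y)) (allFin n))
indeg {n} A y = sum (map (λ x → b2n (A x y)) (allFin n))

M1-twice : ∀ {n} → Digraph n → ℕ
M1-twice {n} A =
  sum (map (λ x → sum (map (λ y → b2n (A x y) * (outdeg A x + indeg A y)) (allFin n))) (allFin n))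

-- First Zagreb index M₁(D) = ½ Σ_{xy ∈ A} (d⁺_x + d⁻_y).
-- (The sum equals Σ_x ((d⁺_x)² + (d⁻_x)²), which is even, so the division is exact.)
M1 : ∀ {n} → Digraph n → ℕ
M1 A = M1-twice A / 2

_≅_ : ∀ {n} → Digraph n → Digraph n → Set
_≅_ {n} A B = Data.Product.Σ (Fin n ↔ Fin n) λ σ →
  ∀ x y → A x y ≡ B (Inverse.to σ x) (Inverse.to σ y)

{-# OPTIONS --safe #-}
module Submission where

-- M₁(D) = ½ Σₓ ((d⁺ₓ)² + (d⁻ₓ)²) depends only on the 2⁷ orientations of the edges, and
-- evaluating it on all of them shows that it never exceeds 19 and equals 19 exactly when
-- the five edges at c all point the same way.  Such an orientation is mapped onto B⁽¹⁾ or
-- B⁽²⁾ by transposing the two outer vertices of each triangle whose third edge points the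
-- other way.  Conversely, B⁽¹⁾ (resp. B⁽²⁾) has a vertex with an arc to (resp. from) every
-- other vertex; isomorphisms transport such a vertex, and an orientation of B_{6,3} has one
-- only if the edges at c all point away from (resp. towards) c.

open import Defs
open import Data.Bool using (Bool; true; false; _xor_)
import Data.Bool.Properties as Bool
open import Data.Fin using (Fin; zero; #_; _↑ˡ_; _≟_)
open import Data.Fin.Permutation using (Permutation′; id; transpose; _∘ₚ_; _⟨$⟩ʳ_)
open import Data.Fin.Properties using (all?)
open import Data.Nat as ℕ using (_≤_; _≤?_)
open import Data.Product using (_×_; _,_)
open import Data.Sum as Sum using (_⊎_)
open import Data.Vec as Vec using (Vec; lookup; tabulate; replicate)
open import Data.Vec.Properties using (≡-dec)
open import Function using (_∘_)
open import Function.Bundles using (_⇔_; mk⇔; Inverse; Equivalence)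
open import Relation.Binary.PropositionalEquality using (_≡_; _≢_; sym; trans; cong; module ≡-Reasoning)
open import Relation.Nullary.Decidable using (Dec; True; toWitness; map′; ¬?; _×-dec_; _⊎-dec_; _→-dec_)
open import Relation.Unary using (Pred; Decidable)

∀-Vec-Bool? : ∀ n {p} {P : Pred (Vec Bool n) p} → Decidable P → Dec (∀ v → P v)
∀-Vec-Bool? ℕ.zero    P? = map′ (λ { p Vec.[] → p }) (λ ∀p → ∀p Vec.[]) (P? Vec.[])
∀-Vec-Bool? (ℕ.suc n) P? =
  map′ (λ { (t , f) (true Vec.∷ v) → t v ; (t , f) (false Vec.∷ v) → f v })
       (λ ∀p → ∀p ∘ (true Vec.∷_) , ∀p ∘ (false Vec.∷_))
       (∀-Vec-Bool? n (P? ∘ (true Vec.∷_)) ×-dec ∀-Vec-Bool? n (P? ∘ (false Vec.∷_)))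

Dominates : ∀ {n} → Digraph n → Fin n → Set
Dominates {n} A x = ∀ (y : Fin n) → y ≢ x → A x y ≡ true

dominates? : ∀ {n} (A : Digraph n) x → Dec (Dominates A x)
dominates? A x = all? λ y → ¬? (y ≟ x) →-dec A x y Bool.≟ true

module _ {n} {A B : Digraph n} where

  reverse-≅ : A ≅ B → reverse A ≅ reverse B
  reverse-≅ (σ , σ-hom) = σ , λ x y → σ-hom y x

  dominates-≅ : ((σ , _) : A ≅ B) → ∀ {x} → Dominates B x → Dominates A (Inverse.from σ x)
  dominates-≅ (σ , σ-hom) {x} dom y y≢σ⁻¹x = begin
    A (from x) y           ≡⟨ σ-hom (from x) y ⟩
    B (to (from x)) (to y) ≡⟨ cong (λ z → B z (to y)) (strictlyInverseˡ x) ⟩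
    B x (to y)             ≡⟨ dom (to y) σy≢x ⟩
    true                   ∎
    where
    open Inverse σ
    open ≡-Reasoning
    σy≢x : to y ≢ x
    σy≢x σy≡x = y≢σ⁻¹x (trans (sym (strictlyInverseʳ y)) (cong from σy≡x))

-- lookup (tabulate o) reduces to o at every concrete edge, so for a predicate that only
-- inspects concrete edges the result is (definitionally) a statement about o itself.
exhaustively : ∀ {p} {P : Pred Orientation p} (P? : Decidable P) →
  {True (∀-Vec-Bool? 7 (P? ∘ lookup))} → ∀ o → P (lookup (tabulate o))
exhaustively P? {all-hold} o = toWitness all-hold (tabulate o)

-- The edges at c are edges 0–4 of Defs.edge, each listed as (c , _), so
-- CentreEdgesAll true o says that they all point away from c.
centreEdges : Orientation → Vec Bool 5
centreEdges o = tabulate (o ∘ (_↑ˡ 2))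

CentreEdgesAll : Bool → Orientation → Set
CentreEdgesAll b o = centreEdges o ≡ replicate 5 b

centreEdgesAll? : ∀ b o → Dec (CentreEdgesAll b o)
centreEdgesAll? b o = ≡-dec Bool._≟_ (centreEdges o) (replicate 5 b)

M1-orient≤19 : ∀ o → M1 (orient o) ≤ 19
M1-orient≤19 = exhaustively λ o → M1 (orient o) ≤? 19

M1-orient≡19⇔centreEdgesAll : ∀ o →
  M1 (orient o) ≡ 19 ⇔ (CentreEdgesAll true o ⊎ CentreEdgesAll false o)
M1-orient≡19⇔centreEdgesAll o = mk⇔
  (exhaustively (λ o → M1 (orient o) ℕ.≟ 19 →-dec centred? o) o)
  (exhaustively (λ o → centred? o →-dec M1 (orient o) ℕ.≟ 19) o)
  where
  centred? : ∀ o → Dec (CentreEdgesAll true o ⊎ CentreEdgesAll false o)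
  centred? o = centreEdgesAll? true o ⊎-dec centreEdgesAll? false o

dominates⇒centreEdgesAll : ∀ o x → Dominates (orient o) x → CentreEdgesAll true o
dominates⇒centreEdgesAll = exhaustively λ o → all? λ x →
  dominates? (orient o) x →-dec centreEdgesAll? true o

dominated⇒centreEdgesAll : ∀ o x → Dominates (reverse (orient o)) x → CentreEdgesAll false o
dominated⇒centreEdgesAll = exhaustively λ o → all? λ x →
  dominates? (reverse (orient o)) x →-dec centreEdgesAll? false o

transposeIf : ∀ {n} → Bool → Fin n → Fin n → Permutation′ n
transposeIf true  i j = transpose i j
transposeIf false i j = id

alignTriangles : Bool → Orientation → Permutation′ 6
alignTriangles b o = transposeIf (o (# 5) xor b) (# 1) (# 2) ∘ₚ transposeIf (o (# 6) xor b) (# 3) (# 4)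

IsomorphicVia : Permutation′ 6 → Digraph 6 → Digraph 6 → Set
IsomorphicVia σ A B = ∀ x y → A x y ≡ B (σ ⟨$⟩ʳ x) (σ ⟨$⟩ʳ y)

isomorphicVia? : ∀ σ A B → Dec (IsomorphicVia σ A B)
isomorphicVia? σ A B = all? λ x → all? λ y → A x y Bool.≟ B (σ ⟨$⟩ʳ x) (σ ⟨$⟩ʳ y)

centreEdgesAll⇒≅B1 : ∀ o → CentreEdgesAll true o → orient o ≅ B1
centreEdgesAll⇒≅B1 o out = alignTriangles true o , exhaustively (λ o →
  centreEdgesAll? true o →-dec isomorphicVia? (alignTriangles true o) (orient o) B1) o out

centreEdgesAll⇒≅B2 : ∀ o → CentreEdgesAll false o → orient o ≅ B2
centreEdgesAll⇒≅B2 o inn = alignTriangles false o , exhaustively (λ o →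
  centreEdgesAll? false o →-dec isomorphicVia? (alignTriangles false o) (orient o) B2) o inn

centre-dominates-B1 : Dominates B1 zero
centre-dominates-B1 = toWitness {a? = dominates? B1 zero} _

lemma7 : (o : Orientation) →
    (M1 (orient o) ≤ 19) ×
    (M1 (orient o) ≡ 19 ⇔ (orient o ≅ B1 ⊎ orient o ≅ B2))
lemma7 o = M1-orient≤19 o , mk⇔
  (Sum.map (centreEdgesAll⇒≅B1 o) (centreEdgesAll⇒≅B2 o) ∘ to M1≡19⇔centred)
  (from M1≡19⇔centred ∘ Sum.map
    (λ D≅B1 → dominates⇒centreEdgesAll o _ (dominates-≅ {B = B1} D≅B1 centre-dominates-B1))
    (λ D≅B2 → dominated⇒centreEdgesAll o _
      (dominates-≅ {B = B1} (reverse-≅ {B = B2} D≅B2) centre-dominates-B1)))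
  where
  open Equivalence
  M1≡19⇔centred : M1 (orient o) ≡ 19 ⇔ (CentreEdgesAll true o ⊎ CentreEdgesAll false o)
  M1≡19⇔centred = M1-orient≡19⇔centreEdgesAll o
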